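{- If $G$ is a connected graph, then $W_{def}(G)\leq 1+def(G)+(\mathrm{diam}(G)+1)\left(\Delta(G)-1\right)$, where $\mathrm{diam}(G)$ is the diameter and $\Delta(G)$ the maximum degree of $G$.
   Context: All graphs are finite, undirected, without loops or multiple edges. A proper $t$-edge-coloring of $G$ is a map $\alpha:E(G)\to\{1,\ldots,t\}$ such that all $t$ colors are used and adjacent edges receive different colors. The spectrum $S(v,\alpha)$ of a vertex $v$ is the set of colors on edges incident to $v$. For a finite set $A$ of integers, $def(A)=\max A-\min A-|A|+1$ ($def(\emptyset)=0$). Define $def(v,\alpha)=def(S(v,\alpha))$, $def(G,\alpha)=\sum_{v\in V(G)}def(v,\alpha)$, and $def(G)=\min_\alpha def(G,\alpha)$ over all proper edge-colorings $\alpha$ of $G$. $W_{def}(G)$ is the largest $t$ such that $G$ has a proper $t$-edge-coloring $\alpha$ with $def(G,\alpha)=def(G)$. -}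

module Defs where

open import Data.Bool using (Bool; true; false; T)
open import Data.Nat using (ℕ; zero; suc; _+_; _∸_; _≤_; _⊔_; _⊓_)
open import Data.Nat.Properties using (_≟_)
open import Data.Fin using (Fin)
open import Data.List using (List; []; _∷_; map; filterᵇ; length; foldr; deduplicate; allFin)
open import Data.Product using (Σ; ∃; _×_; _,_)
open import Relation.Binary.PropositionalEquality using (_≡_; _≢_)
open import Relation.Nullary using (¬_)

record Graph (n : ℕ) : Set where
  field
    adj    : Fin n → Fin n → Bool
    sym    : ∀ u v → adj u v ≡ adj v u
    irrefl : ∀ v → adj v v ≡ false
open Graph public

Adj : ∀ {n} → Graph n → Fin n → Fin n → Set
Adj G u v = T (adj G u v)

nbrs : ∀ {n} → Graph n → Fin n → List (Fin n)
nbrs G v = filterᵇ (adj G v) (allFin _)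

degree : ∀ {n} → Graph n → Fin n → ℕ
degree G v = length (nbrs G v)

maxDegree : ∀ {n} → Graph n → ℕ
maxDegree {n} G = foldr _⊔_ 0 (map (degree G) (allFin n))

data Walk {n} (G : Graph n) : Fin n → Fin n → ℕ → Set where
  here : ∀ {v} → Walk G v v 0
  step : ∀ {u w v k} → Adj G u w → Walk G w v k → Walk G u v (suc k)

-- connected (and nonempty vertex set)
Connected : ∀ {n} → Graph n → Set
Connected {n} G = Fin n × (∀ u v → ∃ λ k → Walk G u v k)

IsDist : ∀ {n} → Graph n → Fin n → Fin n → ℕ → Set
IsDist G u v d = Walk G u v d × (∀ k → Walk G u v k → d ≤ k)

IsDiam : ∀ {n} → Graph n → ℕ → Set
IsDiam {n} G D =
  (∃ λ u → ∃ λ v → IsDist G u v D) × (∀ u v d → IsDist G u v d → d ≤ D)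

-- A proper t-edge-colouring, given as a symmetric function on adjacent pairs
-- (values on non-adjacent pairs are irrelevant).
record ProperColoring {n} (G : Graph n) (t : ℕ) : Set where
  field
    col      : Fin n → Fin n → ℕ
    col-sym  : ∀ u v → Adj G u v → col u v ≡ col v u
    col-range : ∀ u v → Adj G u v → 1 ≤ col u v × col u v ≤ t
    col-onto : ∀ k → 1 ≤ k → k ≤ t → ∃ λ u → ∃ λ v → Adj G u v × col u v ≡ k
    proper   : ∀ u v w → Adj G u v → Adj G u w → v ≢ w → col u v ≢ col u w
open ProperColoring public

-- def(A) = max A - min A - |A| + 1 for a finite set A (given as a list,
-- duplicates removed), def(∅) = 0.
defSet : List ℕ → ℕ
defSet [] = 0
defSet (x ∷ xs) =
  suc (foldr _⊔_ x xs) ∸ foldr _⊓_ x xs ∸ length (deduplicate _≟_ (x ∷ xs))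

spectrum : ∀ {n} {G : Graph n} {t} → ProperColoring G t → Fin n → List ℕ
spectrum {G = G} α v = map (col α v) (nbrs G v)

defVertex : ∀ {n} {G : Graph n} {t} → ProperColoring G t → Fin n → ℕ
defVertex α v = defSet (spectrum α v)

defColoring : ∀ {n} {G : Graph n} {t} → ProperColoring G t → ℕ
defColoring {n} α = foldr _+_ 0 (map (defVertex α) (allFin n))

IsDef : ∀ {n} → Graph n → ℕ → Set
IsDef G d =
  (∃ λ t → Σ (ProperColoring G t) λ α → defColoring α ≡ d) ×
  (∀ t (α : ProperColoring G t) → d ≤ defColoring α)

IsWdef : ∀ {n} → Graph n → ℕ → Set
IsWdef G W = Σ ℕ λ d → IsDef G d ×
  ((Σ (ProperColoring G W) λ α → defColoring α ≡ d) ×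
   (∀ t (α : ProperColoring G t) → defColoring α ≡ d → t ≤ W))

-- Take an optimal colouring with W colours, an edge of colour 1 at a vertex a, an edge of colour W
-- at a vertex x, and a shortest a–x path; it has at most diam(G) + 1 vertices, all distinct.  Two
-- colours at a vertex v differ by at most max S(v) − min S(v) = def(v) + |S(v)| − 1 ≤ def(v) + Δ − 1,
-- so passing from colour 1 to colour W along the path gives
-- W − 1 ≤ Σ_v (def(v) + Δ − 1) ≤ def(G) + (diam(G) + 1)(Δ − 1).
module Submission where

open import Defs
open import Data.Nat using (ℕ)

open import Data.Bool using (T)
open import Data.Bool.Properties using (T?)
open import Data.Fin using (Fin)
open import Data.Fin.Properties using (any?) renaming (_≟_ to _≟ᶠ_)
open import Data.List using (List; []; _∷_; _++_; map; length; foldr; deduplicate; allFin)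
open import Data.List.Membership.Propositional using (_∈_)
open import Data.List.Membership.Propositional.Properties using (∈-∃++; ∈-allFin; ∈-map⁺; ∈-filter⁺; ∈-length)
open import Data.List.Relation.Binary.Subset.Propositional using (_⊆_)
open import Data.List.Relation.Unary.Any as Any using (here; there)
open import Data.List.Relation.Unary.All as All using ([])
open import Data.List.Relation.Unary.All.Properties using (¬Any⇒All¬)
open import Data.List.Relation.Unary.Unique.Propositional using (Unique; []; _∷_)
open import Data.Product using (∃; _×_; _,_)
open import Data.Sum as Sum using ([_,_])
open import Function using (_∘_)
open import Relation.Nullary using (Dec; ¬_; yes; no; contradiction)
open import Relation.Nullary.Decidable using (map′; _×-dec_)
open import Relation.Unary using (Pred; Decidable)
open import Relation.Binary.PropositionalEquality as ≡ using (_≡_; _≢_; refl; trans; cong; subst; ≢-sym)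

-- ℕ arithmetic is opened only inside this module: the theorem at the end uses ℤ's _+_, _*_ and _≤_.
module _ where
  open import Data.Nat using (zero; suc; _+_; _*_; _∸_; _⊔_; _⊓_; _≤_; _<_; z≤n; s≤s)
  open import Data.Nat.Properties
  open import Data.Nat.Induction using (<-rec)
  open import Data.Nat.ListAction using (sum)
  open import Data.Nat.Tactic.RingSolver using (solve-∀)
  open import Data.List.Properties using (foldr-preservesᵒ; length-map; length-deduplicate)
  open import Algebra.Properties.CommutativeSemigroup +-commutativeSemigroup using (x∙yz≈y∙xz; interchange)

  Least : ∀ {p} → Pred ℕ p → Set p
  Least P = ∃ λ m → P m × (∀ i → P i → m ≤ i)

  least-witness : ∀ {p} {P : Pred ℕ p} → Decidable P → ∀ {k} → P k → Least P
  least-witness {P = P} P? {k} = <-rec (λ k → P k → Least P) search k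
    where
    search : ∀ k → (∀ {j} → j < k → P j → Least P) → P k → Least P
    search k smaller Pk with anyUpTo? P? k
    ... | yes (j , j<k , Pj) = smaller j<k Pj
    ... | no ∄j<k            = k , Pk , λ i Pi → ≮⇒≥ λ i<k → ∄j<k (i , i<k , Pi)

  ∈⇒≤foldr-⊔ : ∀ {a e xs} → a ∈ e ∷ xs → a ≤ foldr _⊔_ e xs
  ∈⇒≤foldr-⊔ {e = e} {xs} =
    foldr-preservesᵒ (λ m n → [ m≤n⇒m≤n⊔o n , m≤n⇒m≤o⊔n m ]) e xs
    ∘ Sum.map ≤-reflexive (Any.map ≤-reflexive) ∘ Any.toSum

  ∈⇒foldr-⊓≤ : ∀ {a e xs} → a ∈ e ∷ xs → foldr _⊓_ e xs ≤ a
  ∈⇒foldr-⊓≤ {e = e} {xs} =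
    foldr-preservesᵒ (λ m n → [ m≤n⇒m⊓o≤n n , m≤n⇒o⊓m≤n m ]) e xs
    ∘ Sum.map (≤-reflexive ∘ ≡.sym) (Any.map (≤-reflexive ∘ ≡.sym)) ∘ Any.toSum

  defSet-spread : ∀ {a c} l → a ∈ l → c ∈ l → a < c + length l + defSet l
  defSet-spread {a} {c} (x ∷ xs) a∈ c∈ = begin-strict
    a                                      <⟨ s≤s (∈⇒≤foldr-⊔ a∈) ⟩
    suc M                                  ≤⟨ m≤n+m∸n (suc M) (m + L) ⟩
    m + L + (suc M ∸ (m + L))              ≡⟨ cong (m + L +_) (≡.sym (∸-+-assoc (suc M) m L)) ⟩
    m + L + defSet (x ∷ xs)                ≤⟨ +-monoˡ-≤ _ (+-mono-≤ (∈⇒foldr-⊓≤ c∈) (length-deduplicate _≟_ (x ∷ xs))) ⟩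
    c + length (x ∷ xs) + defSet (x ∷ xs)  ∎
    where
    open ≤-Reasoning
    M = foldr _⊔_ x xs
    m = foldr _⊓_ x xs
    L = length (deduplicate _≟_ (x ∷ xs))

  sum-map-++-∷ : ∀ {A : Set} (f : A → ℕ) xs {x} ys →
                 sum (map f (xs ++ x ∷ ys)) ≡ f x + sum (map f (xs ++ ys))
  sum-map-++-∷ f []       ys = refl
  sum-map-++-∷ f (y ∷ xs) ys =
    trans (cong (f y +_) (sum-map-++-∷ f xs ys)) (x∙yz≈y∙xz (f y) _ (sum (map f (xs ++ ys))))

  sum-map-+ˡ : ∀ {A : Set} c (f : A → ℕ) xs →
               sum (map (λ x → c + f x) xs) ≡ length xs * c + sum (map f xs)
  sum-map-+ˡ c f []       = refl
  sum-map-+ˡ c f (x ∷ xs) = trans (cong (c + f x +_) (sum-map-+ˡ c f xs)) (interchange c (f x) _ _)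

  ∈-++-∷⁻ : ∀ {A : Set} {a x : A} xs {ys} → a ∈ xs ++ x ∷ ys → a ≢ x → a ∈ xs ++ ys
  ∈-++-∷⁻ []       (here a≡x) a≢x = contradiction a≡x a≢x
  ∈-++-∷⁻ []       (there a∈) _   = a∈
  ∈-++-∷⁻ (y ∷ xs) (here a≡y) _   = here a≡y
  ∈-++-∷⁻ (y ∷ xs) (there a∈) a≢x = there (∈-++-∷⁻ xs a∈ a≢x)

  sum-map-mono-⊆ : ∀ {A : Set} (f : A → ℕ) {xs ys} → Unique xs → xs ⊆ ys →
                   sum (map f xs) ≤ sum (map f ys)
  sum-map-mono-⊆ f []                         _     = z≤n
  sum-map-mono-⊆ f {x ∷ xs} (x≢xs ∷ xs-unique) xs⊆ys with ∈-∃++ (xs⊆ys (here refl))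
  ... | ys₁ , ys₂ , refl = begin
    f x + sum (map f xs)            ≤⟨ +-monoʳ-≤ (f x) (sum-map-mono-⊆ f xs-unique xs⊆ys₁++ys₂) ⟩
    f x + sum (map f (ys₁ ++ ys₂))  ≡⟨ ≡.sym (sum-map-++-∷ f ys₁ ys₂) ⟩
    sum (map f (ys₁ ++ x ∷ ys₂))    ∎
    where
    open ≤-Reasoning
    xs⊆ys₁++ys₂ : xs ⊆ ys₁ ++ ys₂
    xs⊆ys₁++ys₂ a∈ = ∈-++-∷⁻ ys₁ (xs⊆ys (there a∈)) (≢-sym (All.lookup x≢xs a∈))

  cancel-walk-length : ∀ {t j D e δ} → j ≤ D → t + suc j ≤ 1 + (suc j * suc δ + e) →
                       t ≤ 1 + e + (D + 1) * δ
  cancel-walk-length {t} {j} {D} {e} {δ} j≤D bound =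
    ≤-trans t≤ (+-monoʳ-≤ (1 + e) (*-monoˡ-≤ δ suc[j]≤D+1))
    where
    rearrange : ∀ j δ e → 1 + (suc j * suc δ + e) ≡ 1 + e + suc j * δ + suc j
    rearrange = solve-∀
    t≤ : t ≤ 1 + e + suc j * δ
    t≤ = +-cancelʳ-≤ (suc j) t _ (≤-trans bound (≤-reflexive (rearrange j δ e)))
    suc[j]≤D+1 : suc j ≤ D + 1
    suc[j]≤D+1 = ≤-trans (s≤s j≤D) (≤-reflexive (+-comm 1 D))

  IsDef-unique : ∀ {n} {G : Graph n} {d d′} → IsDef G d → IsDef G d′ → d ≡ d′
  IsDef-unique ((_ , α , α≡d) , d-min) ((_ , α′ , α′≡d′) , d′-min) =
    ≤-antisym (≤-trans (d-min _ α′) (≤-reflexive α′≡d′)) (≤-trans (d′-min _ α) (≤-reflexive α≡d))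

  module _ {n : ℕ} (G : Graph n) where

    vertices : ∀ {u v k} → Walk G u v k → List (Fin n)
    vertices {v = v} here       = v ∷ []
    vertices {u = u} (step _ w) = u ∷ vertices w

    length-vertices : ∀ {u v k} (w : Walk G u v k) → length (vertices w) ≡ suc k
    length-vertices here       = refl
    length-vertices (step _ w) = cong suc (length-vertices w)

    walk? : ∀ k u v → Dec (Walk G u v k)
    walk? zero    u v = map′ (λ { refl → here }) (λ { here → refl }) (u ≟ᶠ v)
    walk? (suc k) u v = map′ (λ (_ , u~w , w) → step u~w w) (λ { (step u~w w) → _ , u~w , w })
                             (any? λ w → T? (adj G u w) ×-dec walk? k w v)

    distance : ∀ {u v} → (∃ λ k → Walk G u v k) → ∃ (IsDist G u v)
    distance {u} {v} (_ , w) = least-witness (λ k → walk? k u v) w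

    walk-from-vertex : ∀ {u v k a} (w : Walk G u v k) → a ∈ vertices w → ∃ λ k′ → k′ ≤ k × Walk G a v k′
    walk-from-vertex here         (here refl) = 0 , z≤n , here
    walk-from-vertex (step u~w w) (here refl) = _ , ≤-refl , step u~w w
    walk-from-vertex (step _ w)   (there a∈)  =
      let k′ , k′≤k , w′ = walk-from-vertex w a∈ in k′ , m≤n⇒m≤1+n k′≤k , w′

    shortest⇒unique : ∀ {u v k} (w : Walk G u v k) → (∀ i → Walk G u v i → k ≤ i) → Unique (vertices w)
    shortest⇒unique here         _        = [] ∷ []
    shortest⇒unique {u} (step u~w w) shortest =
      ¬Any⇒All¬ (vertices w) u∉w ∷ shortest⇒unique w (λ i w′ → ≤-pred (shortest (suc i) (step u~w w′)))
      where
      u∉w : ¬ u ∈ vertices w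
      u∉w u∈ = let k′ , k′≤k , w′ = walk-from-vertex w u∈ in <⇒≱ (s≤s k′≤k) (shortest k′ w′)

    Adj-sym : ∀ {u v} → Adj G u v → Adj G v u
    Adj-sym {u} {v} = subst T (Graph.sym G u v)

    Adj⇒∈nbrs : ∀ {u v} → Adj G u v → v ∈ nbrs G u
    Adj⇒∈nbrs {u} {v} = ∈-filter⁺ (T? ∘ adj G u) (∈-allFin v)

    degree≤maxDegree : ∀ v → degree G v ≤ maxDegree G
    degree≤maxDegree v = ∈⇒≤foldr-⊔ (there (∈-map⁺ (degree G) (∈-allFin v)))

    Adj⇒maxDegree≢0 : ∀ {u v} → Adj G u v → maxDegree G ≢ 0
    Adj⇒maxDegree≢0 {u} u~v = m<n⇒n≢0 (≤-trans (∈-length (Adj⇒∈nbrs u~v)) (degree≤maxDegree u))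

    module _ {t} (α : ProperColoring G t) where

      spread : Fin n → ℕ
      spread v = maxDegree G + defVertex α v

      colour-gap : ∀ {v b y} → Adj G v b → Adj G v y → col α v y < col α v b + spread v
      colour-gap {v} {b} {y} v~b v~y = begin-strict
        col α v y                                          <⟨ defSet-spread (spectrum α v) (colour∈ v~y) (colour∈ v~b) ⟩
        col α v b + length (spectrum α v) + defVertex α v  ≤⟨ +-monoˡ-≤ (defVertex α v) (+-monoʳ-≤ (col α v b) |spectrum|≤Δ) ⟩
        col α v b + maxDegree G + defVertex α v            ≡⟨ +-assoc (col α v b) _ _ ⟩
        col α v b + spread v                               ∎
        where
        open ≤-Reasoning
        colour∈ : ∀ {w} → Adj G v w → col α v w ∈ spectrum α v
        colour∈ = ∈-map⁺ (col α v) ∘ Adj⇒∈nbrs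
        |spectrum|≤Δ : length (spectrum α v) ≤ maxDegree G
        |spectrum|≤Δ = ≤-trans (≤-reflexive (length-map (col α v) (nbrs G v))) (degree≤maxDegree v)

      colour-walk : ∀ {u x k b y} (w : Walk G u x k) → Adj G u b → Adj G x y →
                    col α x y + length (vertices w) ≤ col α u b + sum (map spread (vertices w))
      colour-walk {u} {b = b} {y} here u~b u~y = begin
        col α u y + 1         ≡⟨ +-comm _ 1 ⟩
        suc (col α u y)       ≤⟨ colour-gap u~b u~y ⟩
        col α u b + spread u  ≡⟨ cong (col α u b +_) (≡.sym (+-identityʳ (spread u))) ⟩
        col α u b + (spread u + 0) ∎
        where open ≤-Reasoning
      colour-walk {u} {x} {b = b} {y} (step {w = z} u~z w) u~b x~y = begin
        col α x y + suc L          ≡⟨ +-suc _ L ⟩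
        suc (col α x y + L)        ≤⟨ s≤s (colour-walk w (Adj-sym u~z) x~y) ⟩
        suc (col α z u + S)        ≡⟨ cong (λ c → suc (c + S)) (≡.sym (col-sym α u z u~z)) ⟩
        suc (col α u z) + S        ≤⟨ +-monoˡ-≤ S (colour-gap u~b u~z) ⟩
        col α u b + spread u + S   ≡⟨ +-assoc (col α u b) _ S ⟩
        col α u b + (spread u + S) ∎
        where
        open ≤-Reasoning
        L = length (vertices w)
        S = sum (map spread (vertices w))

      colour-path : ∀ {u x k b y} (w : Walk G u x k) → Unique (vertices w) → Adj G u b → Adj G x y →
                    col α x y + suc k ≤ col α u b + (suc k * maxDegree G + defColoring α)
      colour-path {u} {x} {k} {b} {y} w unique u~b x~y = begin
        col α x y + suc k                                                    ≡⟨ cong (col α x y +_) (≡.sym |w|) ⟩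
        col α x y + length vs                                                ≤⟨ colour-walk w u~b x~y ⟩
        col α u b + sum (map spread vs)                                      ≡⟨ cong (col α u b +_) (sum-map-+ˡ (maxDegree G) (defVertex α) vs) ⟩
        col α u b + (length vs * maxDegree G + sum (map (defVertex α) vs))  ≤⟨ +-monoʳ-≤ (col α u b) (+-mono-≤ (≤-reflexive (cong (_* maxDegree G) |w|)) Σvs≤def) ⟩
        col α u b + (suc k * maxDegree G + defColoring α)                    ∎
        where
        open ≤-Reasoning
        vs = vertices w
        |w| = length-vertices w
        Σvs≤def : sum (map (defVertex α) vs) ≤ defColoring α
        Σvs≤def = sum-map-mono-⊆ (defVertex α) unique (λ {v} _ → ∈-allFin v)

    colours-bounded : ∀ {D δ} → Connected G → IsDiam G D → maxDegree G ≡ suc δ →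
                      ∀ {t} (α : ProperColoring G t) → t ≤ 1 + defColoring α + (D + 1) * δ
    colours-bounded _ _ _ {zero} _ = z≤n
    colours-bounded {D} {δ} (_ , walks) (_ , diameter-max) Δ≡ {suc t} α
      with a , b , a~b , ab≡1 ← col-onto α 1 (s≤s z≤n) (s≤s z≤n)
         | x , y , x~y , xy≡t ← col-onto α (suc t) (s≤s z≤n) ≤-refl
      with j , w , shortest ← distance (walks a x)
      = cancel-walk-length (diameter-max a x j (w , shortest)) (begin
          suc t + suc j                                        ≡⟨ cong (_+ suc j) (≡.sym xy≡t) ⟩
          col α x y + suc j                                    ≤⟨ colour-path α w (shortest⇒unique w shortest) a~b x~y ⟩
          col α a b + (suc j * maxDegree G + defColoring α)    ≡⟨ ≡.cong₂ (λ c Δ → c + (suc j * Δ + defColoring α)) ab≡1 Δ≡ ⟩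
          1 + (suc j * suc δ + defColoring α)                  ∎)
      where open ≤-Reasoning

    Wdef-bound : ∀ {d W D δ} → Connected G → IsDef G d → IsWdef G W → IsDiam G D →
                 maxDegree G ≡ suc δ → W ≤ 1 + d + (D + 1) * δ
    Wdef-bound {D = D} {δ} connected isDef (_ , isDef′ , (α , α≡d′) , _) isDiam Δ≡ =
      subst (λ e → _ ≤ 1 + e + (D + 1) * δ) (trans α≡d′ (IsDef-unique isDef′ isDef))
            (colours-bounded connected isDiam Δ≡ α)

    colouring-of-edgeless : maxDegree G ≡ 0 → ∀ {t} → ProperColoring G t → t ≡ 0
    colouring-of-edgeless _   {zero}  _ = refl
    colouring-of-edgeless Δ≡0 {suc t} α =
      let _ , _ , u~v , _ = col-onto α 1 (s≤s z≤n) (s≤s z≤n) in contradiction Δ≡0 (Adj⇒maxDegree≢0 u~v)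

    diameter-of-edgeless : maxDegree G ≡ 0 → ∀ {D} → IsDiam G D → D ≡ 0
    diameter-of-edgeless _   {zero}  _                                = refl
    diameter-of-edgeless Δ≡0 {suc D} ((_ , _ , step u~w _ , _) , _) = contradiction Δ≡0 (Adj⇒maxDegree≢0 u~w)

import Data.Nat as ℕ
open import Data.Nat using (zero; suc; z≤n; s≤s)
open import Data.Integer using (+_; _+_; _*_; _-_; _≤_; +≤+)
open import Data.Integer.Properties using (m-n≡m⊖n; ⊖-≥; pos-*)

+[1+m]-1≡+m : ∀ m → + suc m - + 1 ≡ + m
+[1+m]-1≡+m m = trans (m-n≡m⊖n (suc m) 1) (⊖-≥ (s≤s z≤n))

pos-bound : ∀ d D δ → + (1 ℕ.+ d ℕ.+ (D ℕ.+ 1) ℕ.* δ) ≡ + 1 + + d + (+ D + + 1) * (+ suc δ - + 1)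
pos-bound d D δ rewrite +[1+m]-1≡+m δ = cong (_+_ (+ suc d)) (pos-* (D ℕ.+ 1) δ)

corollary2p4 : ∀ {n} (G : Graph n) → Connected G →
    ∀ (d W D : ℕ) → IsDef G d → IsWdef G W → IsDiam G D →
    + W ≤ + 1 + + d + (+ D + + 1) * (+ maxDegree G - + 1)
corollary2p4 G connected d W D isDef isWdef@(_ , _ , (α , _) , _) isDiam with maxDegree G in Δ≡
... | suc δ = subst (+ W ≤_) (pos-bound d D δ) (+≤+ (Wdef-bound G connected isDef isWdef isDiam Δ≡))
... | zero
  with refl ← colouring-of-edgeless G Δ≡ α
     | refl ← diameter-of-edgeless G Δ≡ isDiam = +≤+ z≤n
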